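{- Let $n\ge 5$ be an odd integer, let $T=\langle n,3n-2,3n-1\rangle$, let $\mathrm F(T)=\max(\mathbb Z\setminus T)$, and let $S=T\cup\{\mathrm F(T)\}=\langle n,3n-2,3n-1,\mathrm F(T)\rangle$. Then there are at least $\frac{n+3}{2}$ different \textsf{L}-shapes $L\subseteq\mathbb N^3$ associated with $\mathrm{Ap}(S,\mathrm F(T))$ (with respect to the generators $n,3n-2,3n-1$).
   Context: For $m\in S\setminus\{0\}$, $\mathrm{Ap}(S,m)=\{s\in S: s-m\notin S\}$. Here a set $L\subseteq\mathbb N^3$ is an \textsf{L}-shape associated with $\mathrm{Ap}(S,\mathrm F(T))$ if (C1) the map $(x,y,z)\mapsto xn+y(3n-2)+z(3n-1)$ is a bijection from $L$ onto $\mathrm{Ap}(S,\mathrm F(T))$, and (C2) whenever $u\in L$ and $v\in\mathbb N^3$ with $v\le u$ componentwise, then $v\in L$. -}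

module Defs where

open import Data.Nat using (ℕ; _+_; _*_; _∸_; _≤_; _<_)
open import Data.Product using (Σ; ∃; _×_; _,_)
open import Data.Sum using (_⊎_)
open import Data.Bool using (Bool; true)
open import Relation.Nullary using (¬_)
open import Relation.Binary.PropositionalEquality using (_≡_)

ℕ³ : Set
ℕ³ = ℕ × ℕ × ℕ

_≤³_ : ℕ³ → ℕ³ → Set
(a , b , c) ≤³ (x , y , z) = (a ≤ x) × (b ≤ y) × (c ≤ z)

φ : ℕ → ℕ³ → ℕ
φ n (x , y , z) = x * n + y * (3 * n ∸ 2) + z * (3 * n ∸ 1)

InT : ℕ → ℕ → Set
InT n s = ∃ λ (v : ℕ³) → φ n v ≡ s

IsFrobeniusT : ℕ → ℕ → Set
IsFrobeniusT n f = (¬ InT n f) × (∀ m → f < m → InT n m)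

InS : ℕ → ℕ → ℕ → Set
InS n f s = InT n s ⊎ (s ≡ f)

-- membership in Ap(S, f) = { s ∈ S : s - f ∉ S }   (s - f taken in ℤ;
-- if s < f then s - f < 0 is not in S)
InAp : ℕ → ℕ → ℕ → Set
InAp n f s = InS n f s × (f ≤ s → ¬ InS n f (s ∸ f))

IsLShape : ℕ → ℕ → (ℕ³ → Bool) → Set
IsLShape n f L =
    (∀ u → L u ≡ true → InAp n f (φ n u))
  × (∀ u v → L u ≡ true → L v ≡ true → φ n u ≡ φ n v → u ≡ v)
  × (∀ s → InAp n f s → ∃ λ u → (L u ≡ true) × (φ n u ≡ s))
  × (∀ u v → L u ≡ true → v ≤³ u → L v ≡ true)

module Submission where

-- Write φ v = degree v · n - deficit v with degree (x , y , z) = x + 3y + 3z and deficit = 2y + z.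
-- For n = 2q + 5 this shows that a n - b (0 ≤ b < n, b = 2y + z, z ≤ 1) lies in T exactly when
-- a ≥ 3 (y + z), whence F(T) = (3q + 5) n - (2q + 3).
--
-- Every order ≺ on ℕ³ given by an integer weight with lexicographic tie-breaking is compatible
-- with addition, so the ≺-least factorisations of the elements of Ap(S, F(T)) form an L-shape:
-- if u is least and v ≤ u, a smaller factorisation of φ v would give, after adding u - v, a
-- smaller one of φ u; and φ v - F(T) ∉ S because S + T ⊆ S.
--
-- The q + 4 = (n + 3)/2 orders by -y, by -x and by the weights n y - T (2y + z), q + 2 ≤ T ≤ 2q + 3,
-- give pairwise different L-shapes: (0 , 0 , 2) is least in its fibre for every weight, whereas
-- (3 , 1 , 0) beats it for -x and -y; and for q + 3 ≤ y, (0 , y , 0) is least for -y and for the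
-- weights with y ≤ T, whereas (5 + 3r , 0 , 1 + 2i) with y = q + 3 + i, q = i + r beats it for -x
-- and for the weights with T < y.

open import Defs
open import Data.Bool using (Bool; true)
open import Data.Empty using (⊥)
open import Data.Fin using (Fin; toℕ)
open import Data.Fin.Properties using (toℕ<n; toℕ-injective)
open import Data.List using (List; []; _∷_; upTo; cartesianProduct)
open import Data.List.Membership.Propositional using (_∈_; lose)
open import Data.List.Membership.Propositional.Properties using (∈-cartesianProduct⁺; ∈-upTo⁺)
import Data.List.Relation.Unary.All as All
open import Data.List.Relation.Unary.Any as Any using (any?; satisfied)
open import Data.List.Relation.Unary.Any.Properties using (¬Any[])
open import Data.Nat
open import Data.Nat.DivMod using (m≡m%n+[m/n]*n; m%n<n; m*n/n≡m)
open import Data.Nat.Divisibility using (divides; ∣m+n∣m⇒∣n; ∣1⇒≡1)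
open import Data.Nat.Properties
open import Algebra.Properties.CommutativeSemigroup +-commutativeSemigroup
  using (xy∙z≈xz∙y; xy∙z≈x∙zy; x∙yz≈y∙xz; interchange)
open import Data.Nat.Tactic.RingSolver using (solve-∀)
open import Data.Product using (Σ; ∃; ∃₂; _×_; _,_; proj₁; proj₂; map₂)
open import Data.Product.Properties using (≡-dec)
open import Data.Sum using (_⊎_; inj₁; inj₂)
open import Function using (_∘_)
open import Relation.Binary.Definitions using (tri<; tri≈; tri>; DecidableEquality)
open import Relation.Binary.PropositionalEquality
open import Relation.Nullary using (¬_; Dec; yes; no; contradiction)
open import Relation.Nullary.Decidable using (_×-dec_; _⊎-dec_; _→-dec_; ¬?; does; dec-true)

_+³_ : ℕ³ → ℕ³ → ℕ³
(a , b , c) +³ (x , y , z) = (a + x , b + y , c + z)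

degree : ℕ³ → ℕ
degree (x , y , z) = x + 3 * y + 3 * z

deficit : ℕ³ → ℕ
deficit (_ , y , z) = 2 * y + z

φ-+³ : ∀ n u v → φ n (u +³ v) ≡ φ n u + φ n v
φ-+³ n (x , y , z) (x′ , y′ , z′) = distrib x y z x′ y′ z′ n (3 * n ∸ 2) (3 * n ∸ 1)
  where
  distrib : ∀ x y z x′ y′ z′ a b c →
            (x + x′) * a + (y + y′) * b + (z + z′) * c ≡ (x * a + y * b + z * c) + (x′ * a + y′ * b + z′ * c)
  distrib = solve-∀

φ-suc : ∀ m x y z → φ (suc m) (x , y , z) ≡ x * suc m + y * suc (3 * m) + z * suc (suc (3 * m))
φ-suc m x y z = cong₂ (λ b c → x * suc m + y * b + z * c) (cong (_∸ 2) (3n≡ m)) (cong (_∸ 1) (3n≡ m))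
  where
  3n≡ : ∀ m → 3 * suc m ≡ 2 + suc (3 * m)
  3n≡ = solve-∀

φ-deficit : ∀ m v → φ (suc m) v + deficit v ≡ degree v * suc m
φ-deficit m (x , y , z) = begin
  φ (suc m) (x , y , z) + (2 * y + z)                                      ≡⟨ cong (_+ (2 * y + z)) (φ-suc m x y z) ⟩
  x * suc m + y * suc (3 * m) + z * suc (suc (3 * m)) + (2 * y + z)        ≡⟨ expand m x y z ⟩
  (x + 3 * y + 3 * z) * suc m                                              ∎
  where
  open ≡-Reasoning
  expand : ∀ m x y z → x * suc m + y * suc (3 * m) + z * suc (suc (3 * m)) + (2 * y + z) ≡ (x + 3 * y + 3 * z) * suc m
  expand = solve-∀

surplus : ℕ³ → ℕ
surplus (x , _ , z) = 2 * x + 3 * z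

two-degree : ∀ x y z → 2 * degree (x , y , z) ≡ 3 * deficit (x , y , z) + surplus (x , y , z)
two-degree x y z = expand x y z
  where
  expand : ∀ x y z → 2 * (x + 3 * y + 3 * z) ≡ 3 * (2 * y + z) + (2 * x + 3 * z)
  expand = solve-∀

fibre-balance : ∀ m u v → φ (suc m) v ≡ φ (suc m) u →
                degree v * suc m + deficit u ≡ degree u * suc m + deficit v
fibre-balance m u v φv≡φu = begin
  degree v * suc m + deficit u            ≡⟨ cong (_+ deficit u) (φ-deficit m v) ⟨
  φ (suc m) v + deficit v + deficit u     ≡⟨ cong (λ s → s + deficit v + deficit u) φv≡φu ⟩
  φ (suc m) u + deficit v + deficit u     ≡⟨ xy∙z≈xz∙y (φ (suc m) u) (deficit v) (deficit u) ⟩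
  φ (suc m) u + deficit u + deficit v     ≡⟨ cong (_+ deficit v) (φ-deficit m u) ⟩
  degree u * suc m + deficit v            ∎
  where open ≡-Reasoning

balance⇒fibre : ∀ m u v → degree v * suc m + deficit u ≡ degree u * suc m + deficit v →
                φ (suc m) v ≡ φ (suc m) u
balance⇒fibre m u v balanced = +-cancelʳ-≡ (deficit v + deficit u) _ _ (begin
  φ (suc m) v + (deficit v + deficit u)   ≡⟨ +-assoc (φ (suc m) v) _ _ ⟨
  φ (suc m) v + deficit v + deficit u     ≡⟨ cong (_+ deficit u) (φ-deficit m v) ⟩
  degree v * suc m + deficit u            ≡⟨ balanced ⟩
  degree u * suc m + deficit v            ≡⟨ cong (_+ deficit v) (φ-deficit m u) ⟨
  φ (suc m) u + deficit u + deficit v     ≡⟨ xy∙z≈x∙zy (φ (suc m) u) (deficit u) (deficit v) ⟩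
  φ (suc m) u + (deficit v + deficit u)   ∎)
  where open ≡-Reasoning

fibre-below : ∀ m u v {e} → φ (suc m) v ≡ φ (suc m) u → degree v + e ≡ degree u →
              deficit v + e * suc m ≡ deficit u
fibre-below m u v {e} φv≡φu deg+e≡ = +-cancelˡ-≡ (degree v * suc m) _ _ (begin
  degree v * suc m + (deficit v + e * suc m)   ≡⟨ regroup (degree v) (deficit v) e (suc m) ⟩
  (degree v + e) * suc m + deficit v           ≡⟨ cong (λ g → g * suc m + deficit v) deg+e≡ ⟩
  degree u * suc m + deficit v                 ≡⟨ fibre-balance m u v φv≡φu ⟨
  degree v * suc m + deficit u                 ∎)
  where
  open ≡-Reasoning
  regroup : ∀ g d e n → g * n + (d + e * n) ≡ (g + e) * n + d
  regroup = solve-∀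

-- Only a point of small surplus can have a factorisation of larger degree in its fibre,
-- because raising the degree by one raises the deficit by n.
degree-≤-in-fibre : ∀ m u v → φ (suc m) v ≡ φ (suc m) u → surplus u + 2 < 3 * suc m → degree v ≤ degree u
degree-≤-in-fibre m u@(x , y , z) v@(x′ , y′ , z′) φv≡φu small with degree v ≤? degree u
... | yes deg≤ = deg≤
... | no deg≰ = contradiction (+-cancelˡ-≤ (3 * deficit u) _ _ three-deficits) (<⇒≱ too-large)
  where
  n : ℕ
  n = suc m
  d : ℕ
  d = degree v ∸ suc (degree u)
  deg≡ : suc (degree u) + d ≡ degree v
  deg≡ = m+[n∸m]≡n (≰⇒> deg≰)
  deficit≡ : deficit v ≡ deficit u + suc d * n
  deficit≡ = +-cancelˡ-≡ (degree u * n) _ _ (begin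
    degree u * n + deficit v                   ≡⟨ fibre-balance m u v φv≡φu ⟨
    degree v * n + deficit u                   ≡⟨ cong (λ g → g * n + deficit u) deg≡ ⟨
    (suc (degree u) + d) * n + deficit u       ≡⟨ regroup (degree u) d n (deficit u) ⟩
    degree u * n + (deficit u + suc d * n)     ∎)
    where
    open ≡-Reasoning
    regroup : ∀ g d n e → (suc g + d) * n + e ≡ g * n + (e + suc d * n)
    regroup = solve-∀
  three-deficits : 3 * deficit u + 3 * (suc d * n) ≤ 3 * deficit u + (surplus u + 2 * suc d)
  three-deficits = begin
    3 * deficit u + 3 * (suc d * n)            ≡⟨ *-distribˡ-+ 3 (deficit u) (suc d * n) ⟨
    3 * (deficit u + suc d * n)                ≤⟨ m≤m+n _ (surplus v) ⟩
    3 * (deficit u + suc d * n) + surplus v    ≡⟨ cong (λ e → 3 * e + surplus v) deficit≡ ⟨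
    3 * deficit v + surplus v                  ≡⟨ two-degree x′ y′ z′ ⟨
    2 * degree v                               ≡⟨ cong (2 *_) deg≡ ⟨
    2 * (suc (degree u) + d)                   ≡⟨ regroup (degree u) d ⟩
    2 * degree u + 2 * suc d                   ≡⟨ cong (_+ 2 * suc d) (two-degree x y z) ⟩
    3 * deficit u + surplus u + 2 * suc d      ≡⟨ +-assoc (3 * deficit u) (surplus u) (2 * suc d) ⟩
    3 * deficit u + (surplus u + 2 * suc d)    ∎
    where
    open ≤-Reasoning
    regroup : ∀ g d → 2 * (suc g + d) ≡ 2 * g + 2 * suc d
    regroup = solve-∀
  too-large : surplus u + 2 * suc d < 3 * (suc d * n)
  too-large = begin-strict
    surplus u + 2 * suc d          ≡⟨ regroup (surplus u) d ⟩
    surplus u + 2 + 2 * d          <⟨ +-monoˡ-< (2 * d) small ⟩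
    3 * n + 2 * d                  ≤⟨ +-monoʳ-≤ (3 * n) (*-mono-≤ (n≤1+n 2) (m≤m*n d n)) ⟩
    3 * n + 3 * (d * n)            ≡⟨ regroup′ n d ⟩
    3 * (suc d * n)                ∎
    where
    open ≤-Reasoning
    regroup : ∀ s d → s + 2 * suc d ≡ s + 2 + 2 * d
    regroup = solve-∀
    regroup′ : ∀ n d → 3 * n + 3 * (d * n) ≡ 3 * (suc d * n)
    regroup′ = solve-∀

m+o≡n⇒m≤n : ∀ {m n} o → m + o ≡ n → m ≤ n
m+o≡n⇒m≤n {m} o refl = m≤m+n m o

deficit-balance : ∀ m v {a b} → φ (suc m) v + b ≡ a * suc m →
                  degree v * suc m + b ≡ a * suc m + deficit v
deficit-balance m v {a} {b} φv+b≡an = begin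
  degree v * suc m + b              ≡⟨ cong (_+ b) (φ-deficit m v) ⟨
  φ (suc m) v + deficit v + b       ≡⟨ xy∙z≈xz∙y (φ (suc m) v) (deficit v) b ⟩
  φ (suc m) v + b + deficit v       ≡⟨ cong (_+ deficit v) φv+b≡an ⟩
  a * suc m + deficit v             ∎
  where open ≡-Reasoning

deficit-decomposition : ∀ m v {a b} → b < suc m → φ (suc m) v + b ≡ a * suc m →
                        ∃ λ d → (degree v ≡ a + d) × (deficit v ≡ d * suc m + b)
deficit-decomposition m v {a} {b} b<n φv+b≡an with a ≤? degree v
... | yes a≤deg = d , sym (m+[n∸m]≡n a≤deg) , +-cancelˡ-≡ (a * suc m) _ _ (begin
  a * suc m + deficit v             ≡⟨ deficit-balance m v {a} {b} φv+b≡an ⟨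
  degree v * suc m + b              ≡⟨ cong (λ g → g * suc m + b) (m+[n∸m]≡n a≤deg) ⟨
  (a + d) * suc m + b               ≡⟨ cong (_+ b) (*-distribʳ-+ (suc m) a d) ⟩
  a * suc m + d * suc m + b         ≡⟨ +-assoc (a * suc m) (d * suc m) b ⟩
  a * suc m + (d * suc m + b)       ∎)
  where
  open ≡-Reasoning
  d : ℕ
  d = degree v ∸ a
... | no a≰deg = contradiction n≤b (<⇒≱ b<n)
  where
  open ≤-Reasoning
  n≤b : suc m ≤ b
  n≤b = +-cancelˡ-≤ (degree v * suc m) (suc m) b (begin
    degree v * suc m + suc m     ≡⟨ +-comm (degree v * suc m) (suc m) ⟩
    suc (degree v) * suc m       ≤⟨ *-monoˡ-≤ (suc m) (≰⇒> a≰deg) ⟩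
    a * suc m                    ≤⟨ m≤m+n (a * suc m) (deficit v) ⟩
    a * suc m + deficit v        ≡⟨ deficit-balance m v {a} {b} φv+b≡an ⟨
    degree v * suc m + b         ∎)

parity-≤ : ∀ {y z y′ z′} → z ≤ 1 → 2 * y′ + z′ ≡ 2 * y + z → z ≤ z′
parity-≤ z≤n _ = z≤n
parity-≤ {z′ = suc _} (s≤s z≤n) _ = s≤s z≤n
parity-≤ {y} {y′ = y′} {z′ = zero} (s≤s z≤n) e =
  contradiction (trans (sym (+-identityʳ (2 * y′))) (trans e (+-comm (2 * y) 1))) (even≢odd y′ y)

deficit-bound : ∀ m v {a y z} → 1 ≤ m → z ≤ 1 → 2 * y + z < suc m →
                φ (suc m) v + (2 * y + z) ≡ a * suc m → 3 * (y + z) ≤ a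
deficit-bound zero _ () _ _ _
deficit-bound m@(suc k) v@(x′ , y′ , z′) {a} {y} {z} _ z≤1 b<n φv+b≡an
  with deficit-decomposition m v {a} b<n φv+b≡an
... | d , deg≡ , def≡ = *-cancelˡ-≤ 2 (+-cancelʳ-≤ (2 * d) _ _ (begin
  2 * (3 * (y + z)) + 2 * d                  ≡⟨ cong (_+ 2 * d) (six-ceil y z) ⟩
  3 * b + 3 * z + 2 * d                      ≤⟨ step d def≡ ⟩
  3 * (d * suc m + b) + (2 * x′ + 3 * z′)    ≡⟨ cong (λ e → 3 * e + (2 * x′ + 3 * z′)) def≡ ⟨
  3 * deficit v + (2 * x′ + 3 * z′)          ≡⟨ two-degree x′ y′ z′ ⟨
  2 * degree v                               ≡⟨ cong (2 *_) deg≡ ⟩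
  2 * (a + d)                                ≡⟨ *-distribˡ-+ 2 a d ⟩
  2 * a + 2 * d                              ∎))
  where
  open ≤-Reasoning
  b : ℕ
  b = 2 * y + z
  six-ceil : ∀ y z → 2 * (3 * (y + z)) ≡ 3 * (2 * y + z) + 3 * z
  six-ceil = solve-∀
  expand : ∀ b d k → 3 * b + 3 + 2 * suc d + (1 + 4 * d + 3 * k + 3 * d * k) ≡ 3 * (suc d * suc (suc k) + b)
  expand = solve-∀
  step : ∀ d → deficit v ≡ d * suc m + b →
         3 * b + 3 * z + 2 * d ≤ 3 * (d * suc m + b) + (2 * x′ + 3 * z′)
  step zero def≡b = begin
    3 * b + 3 * z + 0            ≡⟨ +-identityʳ _ ⟩
    3 * b + 3 * z                ≤⟨ +-monoʳ-≤ (3 * b) (*-monoʳ-≤ 3 (parity-≤ {y} {z} {y′} {z′} z≤1 def≡b)) ⟩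
    3 * b + 3 * z′               ≤⟨ +-monoʳ-≤ (3 * b) (m≤n+m (3 * z′) (2 * x′)) ⟩
    3 * b + (2 * x′ + 3 * z′)    ∎
  step (suc d) _ = begin
    3 * b + 3 * z + 2 * suc d    ≤⟨ +-monoˡ-≤ (2 * suc d) (+-monoʳ-≤ (3 * b) (*-monoʳ-≤ 3 z≤1)) ⟩
    3 * b + 3 + 2 * suc d        ≤⟨ m+o≡n⇒m≤n _ (expand b d k) ⟩
    3 * (suc d * suc m + b)      ≤⟨ m≤m+n _ (2 * x′ + 3 * z′) ⟩
    3 * (suc d * suc m + b) + (2 * x′ + 3 * z′) ∎

InT-of-deficit : ∀ m {s a y z} → 3 * (y + z) ≤ a → s + (2 * y + z) ≡ a * suc m → InT (suc m) s
InT-of-deficit m {s} {a} {y} {z} bound s+b≡an = w , +-cancelʳ-≡ (deficit w) (φ (suc m) w) s (begin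
  φ (suc m) w + deficit w     ≡⟨ φ-deficit m w ⟩
  degree w * suc m            ≡⟨ cong (_* suc m) degree-w ⟩
  a * suc m                   ≡⟨ s+b≡an ⟨
  s + deficit w               ∎)
  where
  open ≡-Reasoning
  w : ℕ³
  w = (a ∸ 3 * (y + z) , y , z)
  degree-w : degree w ≡ a
  degree-w = trans (+-assoc (a ∸ 3 * (y + z)) (3 * y) (3 * z))
               (trans (cong (a ∸ 3 * (y + z) +_) (sym (*-distribˡ-+ 3 y z))) (m∸n+n≡m bound))

-- (P , N) stands for the integer weight P - N on ℕ³; weight ties are broken by x, then by y.
WeightOrder : Set
WeightOrder = ℕ³ × ℕ³

dot : ℕ³ → ℕ³ → ℕ
dot (a , b , c) (x , y , z) = a * x + b * y + c * z

TieBreak : ℕ³ → ℕ³ → Set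
TieBreak (x , y , _) (x′ , y′ , _) = (x < x′) ⊎ ((x ≡ x′) × (y < y′))

_≺[_]_ : ℕ³ → WeightOrder → ℕ³ → Set
v ≺[ P , N ] u = (dot P v + dot N u < dot P u + dot N v)
               ⊎ ((dot P v + dot N u ≡ dot P u + dot N v) × TieBreak v u)

_≺[_]?_ : ∀ v o u → Dec (v ≺[ o ] u)
(x , y , _) ≺[ P , N ]? (x′ , y′ , _) = (_ <? _) ⊎-dec ((_ ≟ _) ×-dec ((x <? x′) ⊎-dec ((x ≟ x′) ×-dec (y <? y′))))

≺-irrefl : ∀ o u → ¬ u ≺[ o ] u
≺-irrefl o u (inj₁ w<w) = <-irrefl refl w<w
≺-irrefl o u (inj₂ (_ , inj₁ x<x)) = <-irrefl refl x<x
≺-irrefl o u (inj₂ (_ , inj₂ (_ , y<y))) = <-irrefl refl y<y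

-- Comparisons of differences a - b ≤ c - d, written without subtraction.
diff-≤-trans : ∀ {a b c d e f} → a + d ≤ c + b → c + f ≤ e + d → a + f ≤ e + b
diff-≤-trans {a} {b} {c} {d} {e} {f} p q = +-cancelʳ-≤ (c + d) (a + f) (e + b) (begin
  a + f + (c + d)        ≡⟨ shuffle a f c d ⟩
  (a + d) + (c + f)      ≤⟨ +-mono-≤ p q ⟩
  (c + b) + (e + d)      ≡⟨ shuffle′ c b e d ⟩
  e + b + (c + d)        ∎)
  where
  open ≤-Reasoning
  shuffle : ∀ a f c d → a + f + (c + d) ≡ (a + d) + (c + f)
  shuffle = solve-∀
  shuffle′ : ∀ c b e d → (c + b) + (e + d) ≡ e + b + (c + d)
  shuffle′ = solve-∀

diff-≡-trans : ∀ {a b c d e f} → a + d ≡ c + b → c + f ≡ e + d → a + f ≡ e + b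
diff-≡-trans {a} {b} {c} {d} {e} {f} p q =
  ≤-antisym (diff-≤-trans {a} {b} {c} {d} {e} {f} (≤-reflexive p) (≤-reflexive q))
            (diff-≤-trans {e} {f} {c} {d} {a} {b} (≤-reflexive (sym q)) (≤-reflexive (sym p)))

TieBreak-trans : ∀ {v u w} → TieBreak v u → TieBreak u w → TieBreak v w
TieBreak-trans (inj₁ p) (inj₁ q) = inj₁ (<-trans p q)
TieBreak-trans (inj₁ p) (inj₂ (refl , _)) = inj₁ p
TieBreak-trans (inj₂ (refl , _)) (inj₁ q) = inj₁ q
TieBreak-trans (inj₂ (refl , p)) (inj₂ (refl , q)) = inj₂ (refl , <-trans p q)

≺-trans : ∀ o {v u w} → v ≺[ o ] u → u ≺[ o ] w → v ≺[ o ] w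
≺-trans (P , N) {v} {u} {w} = combine
  where
  chain< : dot P v + dot N u < dot P u + dot N v → dot P u + dot N w ≤ dot P w + dot N u →
           dot P v + dot N w < dot P w + dot N v
  chain< = diff-≤-trans {suc (dot P v)} {dot N v} {dot P u} {dot N u} {dot P w} {dot N w}
  chain<′ : dot P v + dot N u ≤ dot P u + dot N v → dot P u + dot N w < dot P w + dot N u →
            dot P v + dot N w < dot P w + dot N v
  chain<′ p = diff-≤-trans {suc (dot P v)} {dot N v} {suc (dot P u)} {dot N u} {dot P w} {dot N w} (s≤s p)
  chain≡ : dot P v + dot N u ≡ dot P u + dot N v → dot P u + dot N w ≡ dot P w + dot N u →
           dot P v + dot N w ≡ dot P w + dot N v
  chain≡ = diff-≡-trans {dot P v} {dot N v} {dot P u} {dot N u} {dot P w} {dot N w}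
  combine : v ≺[ P , N ] u → u ≺[ P , N ] w → v ≺[ P , N ] w
  combine (inj₁ p) (inj₁ q) = inj₁ (chain< p (<⇒≤ q))
  combine (inj₁ p) (inj₂ (q , _)) = inj₁ (chain< p (≤-reflexive q))
  combine (inj₂ (p , _)) (inj₁ q) = inj₁ (chain<′ (≤-reflexive p) q)
  combine (inj₂ (p , s)) (inj₂ (q , t)) = inj₂ (chain≡ p q , TieBreak-trans {v} {u} {w} s t)

dot-+³ : ∀ P v d → dot P (v +³ d) ≡ dot P v + dot P d
dot-+³ (a , b , c) (x , y , z) (x′ , y′ , z′) = distrib a b c x y z x′ y′ z′
  where
  distrib : ∀ a b c x y z x′ y′ z′ →
            a * (x + x′) + b * (y + y′) + c * (z + z′) ≡ (a * x + b * y + c * z) + (a * x′ + b * y′ + c * z′)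
  distrib = solve-∀

≺-+³ : ∀ o {v u} d → v ≺[ o ] u → (v +³ d) ≺[ o ] (u +³ d)
≺-+³ (P , N) {v} {u} d = translate
  where
  shift : ∀ v u → dot P (v +³ d) + dot N (u +³ d) ≡ (dot P v + dot N u) + (dot P d + dot N d)
  shift v u = trans (cong₂ _+_ (dot-+³ P v d) (dot-+³ N u d)) (interchange (dot P v) (dot P d) (dot N u) (dot N d))
  tie : TieBreak v u → TieBreak (v +³ d) (u +³ d)
  tie (inj₁ p) = inj₁ (+-monoˡ-< _ p)
  tie (inj₂ (refl , p)) = inj₂ (refl , +-monoˡ-< _ p)
  translate : v ≺[ P , N ] u → (v +³ d) ≺[ P , N ] (u +³ d)
  translate (inj₁ p) = inj₁ (subst₂ _<_ (sym (shift v u)) (sym (shift u v)) (+-monoˡ-< (dot P d + dot N d) p))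
  translate (inj₂ (p , s)) = inj₂ (trans (shift v u) (trans (cong (_+ (dot P d + dot N d)) p) (sym (shift u v))) , tie s)

fibre-trichotomy : ∀ m o {v u} → φ (suc m) v ≡ φ (suc m) u → v ≢ u → v ≺[ o ] u ⊎ u ≺[ o ] v
fibre-trichotomy m (P , N) {v@(x , y , z)} {u@(x′ , y′ , z′)} φv≡φu v≢u
  with <-cmp (dot P v + dot N u) (dot P u + dot N v)
... | tri< p _ _ = inj₁ (inj₁ p)
... | tri> _ _ p = inj₂ (inj₁ p)
... | tri≈ _ p _ with <-cmp x x′
...   | tri< q _ _ = inj₁ (inj₂ (p , inj₁ q))
...   | tri> _ _ q = inj₂ (inj₂ (sym p , inj₁ q))
...   | tri≈ _ refl _ with <-cmp y y′
...     | tri< q _ _ = inj₁ (inj₂ (p , inj₂ (refl , q)))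
...     | tri> _ _ q = inj₂ (inj₂ (sym p , inj₂ (refl , q)))
...     | tri≈ _ refl _ = contradiction (cong (λ c → (x , y , c)) z≡z′) v≢u
  where
  z≡z′ : z ≡ z′
  z≡z′ = *-cancelʳ-≡ z z′ (suc (suc (3 * m)))
           (+-cancelˡ-≡ (x * suc m + y * suc (3 * m)) _ _ (trans (sym (φ-suc m x y z)) (trans φv≡φu (φ-suc m x y z′))))

module _ {A : Set} {_<_ : A → A → Set} (<-trans : ∀ {a b c} → a < b → b < c → a < c)
         (<-irrefl : ∀ a → ¬ a < a) (_<?_ : ∀ a b → Dec (a < b))
         {P : A → Set} (P? : ∀ a → Dec (P a)) where

  minimal-element : ∀ (l : List A) c → P c → (∀ w → P w → w < c → w ∈ l) →
                    ∃ λ m → P m × (∀ w → P w → ¬ w < m)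
  minimal-element [] c Pc below = c , Pc , λ w Pw w<c → ¬Any[] (below w Pw w<c)
  minimal-element (v ∷ l) c Pc below with P? v | v <? c
  ... | yes Pv | yes v<c = minimal-element l v Pv λ w Pw w<v →
        Any.tail (λ { refl → <-irrefl w w<v }) (below w Pw (<-trans w<v v<c))
  ... | yes _  | no v≮c  = minimal-element l c Pc λ w Pw w<c →
        Any.tail (λ { refl → v≮c w<c }) (below w Pw w<c)
  ... | no ¬Pv | _       = minimal-element l c Pc λ w Pw w<c →
        Any.tail (λ { refl → ¬Pv Pw }) (below w Pw w<c)

box : ℕ → List ℕ³
box s = cartesianProduct (upTo (suc s)) (cartesianProduct (upTo (suc s)) (upTo (suc s)))

∈-box : ∀ m v → v ∈ box (φ (suc m) v)
∈-box m (x , y , z) = ∈-cartesianProduct⁺ (∈-upTo⁺ (s≤s x≤φ)) (∈-cartesianProduct⁺ (∈-upTo⁺ (s≤s y≤φ)) (∈-upTo⁺ (s≤s z≤φ)))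
  where
  A B C : ℕ
  A = x * suc m
  B = y * suc (3 * m)
  C = z * suc (suc (3 * m))
  φ≡ : A + B + C ≡ φ (suc m) (x , y , z)
  φ≡ = sym (φ-suc m x y z)
  x≤φ : x ≤ φ (suc m) (x , y , z)
  x≤φ = subst (x ≤_) φ≡ (≤-trans (m≤m*n x (suc m)) (≤-trans (m≤m+n A B) (m≤m+n (A + B) C)))
  y≤φ : y ≤ φ (suc m) (x , y , z)
  y≤φ = subst (y ≤_) φ≡ (≤-trans (m≤m*n y (suc (3 * m))) (≤-trans (m≤n+m B A) (m≤m+n (A + B) C)))
  z≤φ : z ≤ φ (suc m) (x , y , z)
  z≤φ = subst (z ≤_) φ≡ (≤-trans (m≤m*n z (suc (suc (3 * m)))) (m≤n+m C (A + B)))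

InT-+ : ∀ {n a b} → InT n a → InT n b → InT n (a + b)
InT-+ {n} (v , refl) (w , refl) = v +³ w , φ-+³ n v w

InS-+ : ∀ {n f a d} → (∀ s → f < s → InT n s) → InS n f a → InT n d → InS n f (a + d)
InS-+ _ (inj₁ a∈T) d∈T = inj₁ (InT-+ a∈T d∈T)
InS-+ {a = a} {zero} _ (inj₂ refl) _ = inj₂ (+-identityʳ a)
InS-+ {a = a} {suc d} above-f (inj₂ refl) _ = inj₁ (above-f (a + suc d) (m<m+n a (s≤s z≤n)))

FibreMinimal : ℕ → WeightOrder → ℕ³ → Set
FibreMinimal n o u = ∀ v → φ n v ≡ φ n u → ¬ v ≺[ o ] u

_≟³_ : DecidableEquality ℕ³
_≟³_ = ≡-dec _≟_ (≡-dec _≟_ _≟_)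

does-true : ∀ {A : Set} (a? : Dec A) → does a? ≡ true → A
does-true (yes a) _ = a

module OrderLShape (m f : ℕ) (above-f : ∀ s → f < s → InT (suc m) s) (o : WeightOrder) where

  private
    n : ℕ
    n = suc m

  InT? : ∀ s → Dec (InT n s)
  InT? s with any? (λ v → φ n v ≟ s) (box s)
  ... | yes found = yes (satisfied found)
  ... | no ¬found = no λ (v , φv≡s) → ¬found (lose (subst (λ t → v ∈ box t) φv≡s (∈-box m v)) φv≡s)

  InS? : ∀ s → Dec (InS n f s)
  InS? s = InT? s ⊎-dec (s ≟ f)

  InAp? : ∀ s → Dec (InAp n f s)
  InAp? s = InS? s ×-dec ((f ≤? s) →-dec ¬? (InS? (s ∸ f)))

  FibreMinimal? : ∀ u → Dec (FibreMinimal n o u)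
  FibreMinimal? u with All.all? (λ v → (φ n v ≟ φ n u) →-dec ¬? (v ≺[ o ]? u)) (box (φ n u))
  ... | yes all = yes λ v φv≡φu → All.lookup all (subst (λ t → v ∈ box t) φv≡φu (∈-box m v)) φv≡φu
  ... | no ¬all = no λ minimal → ¬all (All.tabulate λ {v} _ → minimal v)

  opaque
    L : ℕ³ → Bool
    L u = does (InAp? (φ n u) ×-dec FibreMinimal? u)

    L-intro : ∀ u → InAp n f (φ n u) → FibreMinimal n o u → L u ≡ true
    L-intro u ap minimal = dec-true (InAp? (φ n u) ×-dec FibreMinimal? u) (ap , minimal)

    L-elim : ∀ u → L u ≡ true → InAp n f (φ n u) × FibreMinimal n o u
    L-elim u = does-true (InAp? (φ n u) ×-dec FibreMinimal? u)

  L-injective : ∀ u v → L u ≡ true → L v ≡ true → φ n u ≡ φ n v → u ≡ v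
  L-injective u v Lu Lv φu≡φv with u ≟³ v
  ... | yes u≡v = u≡v
  ... | no u≢v with fibre-trichotomy m o φu≡φv u≢v
  ...   | inj₁ u≺v = contradiction u≺v (proj₂ (L-elim v Lv) u φu≡φv)
  ...   | inj₂ v≺u = contradiction v≺u (proj₂ (L-elim u Lu) v (sym φu≡φv))

  L-surjective : ∀ s → InAp n f s → ∃ λ u → (L u ≡ true) × (φ n u ≡ s)
  L-surjective s (inj₂ refl , ¬f-f∈S) = contradiction (inj₁ ((0 , 0 , 0) , sym (n∸n≡0 s))) (¬f-f∈S ≤-refl)
  L-surjective s ap@(inj₁ (v , φv≡s) , _)
    with minimal-element (λ {a} {b} {c} → ≺-trans o {a} {b} {c}) (≺-irrefl o) (_≺[ o ]?_)
           (λ w → φ n w ≟ s) (box s) v φv≡s (λ w φw≡s _ → subst (λ t → w ∈ box t) φw≡s (∈-box m w))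
  ... | u , φu≡s , least = u , L-intro u (subst (InAp n f) (sym φu≡s) ap) (λ w φw≡φu → least w (trans φw≡φu φu≡s)) , φu≡s

  L-downward-closed : ∀ u v → L u ≡ true → v ≤³ u → L v ≡ true
  L-downward-closed u@(ux , uy , uz) v@(vx , vy , vz) Lu (vx≤ux , vy≤uy , vz≤uz) = L-intro v ap minimal
    where
    d : ℕ³
    d = (ux ∸ vx , uy ∸ vy , uz ∸ vz)
    v+d≡u : v +³ d ≡ u
    v+d≡u = cong₂ _,_ (m+[n∸m]≡n vx≤ux) (cong₂ _,_ (m+[n∸m]≡n vy≤uy) (m+[n∸m]≡n vz≤uz))
    φu≡ : φ n u ≡ φ n v + φ n d
    φu≡ = trans (cong (φ n) (sym v+d≡u)) (φ-+³ n v d)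
    u-ap : InAp n f (φ n u)
    u-ap = proj₁ (L-elim u Lu)
    ap : InAp n f (φ n v)
    ap = inj₁ (v , refl) , λ f≤φv φv-f∈S → proj₂ u-ap (≤-trans f≤φv (subst (φ n v ≤_) (sym φu≡) (m≤m+n _ _)))
           (subst (InS n f) (trans (sym (+-∸-comm (φ n d) f≤φv)) (cong (_∸ f) (sym φu≡)))
             (InS-+ above-f φv-f∈S (d , refl)))
    minimal : FibreMinimal n o v
    minimal w φw≡φv w≺v = proj₂ (L-elim u Lu) (w +³ d)
      (trans (φ-+³ n w d) (trans (cong (_+ φ n d) φw≡φv) (sym φu≡)))
      (subst (λ t → (w +³ d) ≺[ o ] t) v+d≡u (≺-+³ o d w≺v))

  L-isLShape : IsLShape n f L
  L-isLShape = (λ u Lu → proj₁ (L-elim u Lu)) , L-injective , L-surjective , L-downward-closed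

byY : WeightOrder
byY = (0 , 0 , 0) , (0 , 1 , 0)

byX : WeightOrder
byX = (0 , 0 , 0) , (1 , 0 , 0)

weighted : ℕ → ℕ → WeightOrder
weighted n T = (0 , n , 0) , (0 , 2 * T , T)

-- When deficit v + e n = deficit u, comparing the weights of v and u amounts to
-- comparing y(v) + T e with y(u).
weighted-key : ∀ m T {x a c x′ y′ z′} e → deficit (x , a , c) + e * suc m ≡ deficit (x′ , y′ , z′) →
  (dot (0 , suc m , 0) (x , a , c) + dot (0 , 2 * T , T) (x′ , y′ , z′) ≡ suc m * (a + T * e) + T * deficit (x , a , c))
  × (dot (0 , suc m , 0) (x′ , y′ , z′) + dot (0 , 2 * T , T) (x , a , c) ≡ suc m * y′ + T * deficit (x , a , c))
weighted-key m T {x} {a} {c} {x′} {y′} {z′} e balanced =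
  trans (left x a c x′ y′ z′ (suc m) T)
        (trans (cong (λ D → suc m * a + T * D) (sym balanced)) (shift (suc m) a T e (2 * a + c))) ,
  right x a c x′ y′ z′ (suc m) T
  where
  left : ∀ x a c x′ y′ z′ n T → 0 * x + n * a + 0 * c + (0 * x′ + 2 * T * y′ + T * z′) ≡ n * a + T * (2 * y′ + z′)
  left = solve-∀
  shift : ∀ n a T e D → n * a + T * (D + e * n) ≡ n * (a + T * e) + T * D
  shift = solve-∀
  right : ∀ x a c x′ y′ z′ n T → 0 * x′ + n * y′ + 0 * z′ + (0 * x + 2 * T * a + T * c) ≡ n * y′ + T * (2 * a + c)
  right = solve-∀

weighted-≺-shift : ∀ m T {x a c x′ y′ z′} e → deficit (x , a , c) + e * suc m ≡ deficit (x′ , y′ , z′) →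
  (x , a , c) ≺[ weighted (suc m) T ] (x′ , y′ , z′) →
  (a + T * e < y′) ⊎ ((a + T * e ≡ y′) × TieBreak (x , a , c) (x′ , y′ , z′))
weighted-≺-shift m T {x} {a} {c} {x′} {y′} {z′} e balanced
  with weighted-key m T {x} {a} {c} {x′} {y′} {z′} e balanced
... | left≡ , right≡ = read
  where
  K : ℕ
  K = T * deficit (x , a , c)
  read : (x , a , c) ≺[ weighted (suc m) T ] (x′ , y′ , z′) →
         (a + T * e < y′) ⊎ ((a + T * e ≡ y′) × TieBreak (x , a , c) (x′ , y′ , z′))
  read (inj₁ p) = inj₁ (*-cancelˡ-< (suc m) _ _ (+-cancelʳ-< K _ _ (subst₂ _<_ left≡ right≡ p)))
  read (inj₂ (p , tie)) =
    inj₂ (*-cancelˡ-≡ _ _ (suc m) (+-cancelʳ-≡ K _ _ (trans (sym left≡) (trans p right≡))) , tie)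

weighted-≺-intro : ∀ m T {x a c x′ y′ z′} e → deficit (x , a , c) + e * suc m ≡ deficit (x′ , y′ , z′) →
  a + T * e < y′ → (x , a , c) ≺[ weighted (suc m) T ] (x′ , y′ , z′)
weighted-≺-intro m T {x} {a} {c} {x′} {y′} {z′} e balanced lt
  with weighted-key m T {x} {a} {c} {x′} {y′} {z′} e balanced
... | left≡ , right≡ =
  inj₁ (subst₂ _<_ (sym left≡) (sym right≡) (+-monoˡ-< (T * deficit (x , a , c)) (*-monoʳ-< (suc m) lt)))

z-axis-minimal-weighted : ∀ m T → 2 ≤ m → FibreMinimal (suc m) (weighted (suc m) T) (0 , 0 , 2)
z-axis-minimal-weighted m T 2≤m v@(x , a , c) φv≡φu v≺u
  with m≤n⇒∃[o]m+o≡n (degree-≤-in-fibre m (0 , 0 , 2) v φv≡φu (*-monoʳ-≤ 3 (s≤s 2≤m)))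
... | e , deg+e≡ with weighted-≺-shift m T {x} {a} {c} e (fibre-below m (0 , 0 , 2) v φv≡φu deg+e≡) v≺u
...   | inj₁ ()
...   | inj₂ (_ , inj₁ ())
...   | inj₂ (_ , inj₂ (_ , ()))

surplus-zero : ∀ {x z} → 2 * x + 3 * z ≡ 0 → (x ≡ 0) × (z ≡ 0)
surplus-zero {zero} {zero} _ = refl , refl

on-y-axis : ∀ {x a c} y → degree (x , a , c) ≡ degree (0 , y , 0) → deficit (x , a , c) ≡ deficit (0 , y , 0) →
            (x , a , c) ≡ (0 , y , 0)
on-y-axis {x} {a} {c} y deg≡ def≡ = conclude (surplus-zero surplus≡0)
  where
  open ≡-Reasoning
  surplus≡0 : surplus (x , a , c) ≡ 0
  surplus≡0 = +-cancelˡ-≡ (3 * deficit (0 , y , 0)) _ _ (begin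
    3 * deficit (0 , y , 0) + surplus (x , a , c)   ≡⟨ cong (λ d → 3 * d + surplus (x , a , c)) def≡ ⟨
    3 * deficit (x , a , c) + surplus (x , a , c)   ≡⟨ two-degree x a c ⟨
    2 * degree (x , a , c)                          ≡⟨ cong (2 *_) deg≡ ⟩
    2 * degree (0 , y , 0)                          ≡⟨ two-degree 0 y 0 ⟩
    3 * deficit (0 , y , 0) + surplus (0 , y , 0)   ∎)
  conclude : (x ≡ 0) × (c ≡ 0) → (x , a , c) ≡ (0 , y , 0)
  conclude (refl , refl) = cong (λ b → (0 , b , 0)) (*-cancelˡ-≡ a y 2 (+-cancelʳ-≡ 0 _ _ def≡))

3∤3m+1 : ∀ c y → 3 * c + 1 ≢ 3 * y
3∤3m+1 c y e with ∣1⇒≡1 (∣m+n∣m⇒∣n (divides y (trans e (*-comm 3 y))) (divides c (*-comm 3 c)))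
... | ()

-- The tie case: v ≺ (0 , y , 0) with equal weights forces x = 0, and then degree v ≡ 3y - 1.
y-axis-tie-absurd : ∀ T y a c e → 1 ≤ T → y ≤ T → a + T * suc e ≡ y → 3 * a + 3 * c + suc e ≢ 3 * y + 0
y-axis-tie-absurd T y a c e 1≤T y≤T a+Te≡y deg≡ = conclude (m+n≡0⇒m≡0 a rest≡0) e≡0
  where
  rest≡0 : a + T * e ≡ 0
  rest≡0 = n≤0⇒n≡0 (+-cancelˡ-≤ T _ 0 (begin
    T + (a + T * e)        ≡⟨ x∙yz≈y∙xz T a (T * e) ⟩
    a + (T + T * e)        ≡⟨ cong (a +_) (*-suc T e) ⟨
    a + T * suc e          ≡⟨ a+Te≡y ⟩
    y                      ≤⟨ y≤T ⟩
    T                      ≡⟨ +-identityʳ T ⟨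
    T + 0                  ∎))
    where open ≤-Reasoning
  e≡0 : e ≡ 0
  e≡0 with m*n≡0⇒m≡0∨n≡0 T (m+n≡0⇒n≡0 a rest≡0)
  ... | inj₁ refl = contradiction 1≤T λ ()
  ... | inj₂ e≡0 = e≡0
  conclude : a ≡ 0 → e ≡ 0 → ⊥
  conclude refl refl = 3∤3m+1 c y (trans deg≡ (+-identityʳ (3 * y)))

y-axis-minimal-weighted : ∀ m T y → 1 ≤ T → y ≤ T → FibreMinimal (suc m) (weighted (suc m) T) (0 , y , 0)
y-axis-minimal-weighted m T y 1≤T y≤T v@(x , a , c) φv≡φu v≺u
  with m≤n⇒∃[o]m+o≡n (degree-≤-in-fibre m (0 , y , 0) v φv≡φu (*-monoʳ-≤ 3 (s≤s z≤n)))
... | zero , deg≡ = ≺-irrefl (weighted (suc m) T) (0 , y , 0)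
      (subst (λ w → w ≺[ weighted (suc m) T ] (0 , y , 0))
             (on-y-axis y (trans (sym (+-identityʳ _)) deg≡)
                          (trans (sym (+-identityʳ _)) (fibre-below m (0 , y , 0) v φv≡φu deg≡)))
             v≺u)
... | suc e , deg≡ with weighted-≺-shift m T {x} {a} {c} (suc e) (fibre-below m (0 , y , 0) v φv≡φu deg≡) v≺u
...   | inj₁ a+Te<y = <⇒≱ a+Te<y (≤-trans y≤T (≤-trans (m≤m*n T (suc e)) (m≤n+m (T * suc e) a)))
...   | inj₂ (a+Te≡y , inj₂ (refl , _)) = y-axis-tie-absurd T y a c e 1≤T y≤T a+Te≡y deg≡

y-axis-minimal-byY : ∀ m y → FibreMinimal (suc m) byY (0 , y , 0)
y-axis-minimal-byY m y (x , a , c) φv≡φu = absurd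
  where
  a≤y : a ≤ y
  a≤y = *-cancelʳ-≤ a y (suc (3 * m)) (+-cancelʳ-≤ 0 _ _ (begin
    a * suc (3 * m) + 0                                               ≡⟨ +-identityʳ _ ⟩
    a * suc (3 * m)                                                   ≤⟨ m≤n+m _ (x * suc m) ⟩
    x * suc m + a * suc (3 * m)                                       ≤⟨ m≤m+n _ (c * suc (suc (3 * m))) ⟩
    x * suc m + a * suc (3 * m) + c * suc (suc (3 * m))               ≡⟨ φ-suc m x a c ⟨
    φ (suc m) (x , a , c)                                             ≡⟨ φv≡φu ⟩
    φ (suc m) (0 , y , 0)                                             ≡⟨ φ-suc m 0 y 0 ⟩
    y * suc (3 * m) + 0                                               ∎))
    where open ≤-Reasoning
  absurd : ¬ (x , a , c) ≺[ byY ] (0 , y , 0)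
  absurd (inj₁ y<a) = <⇒≱ (subst₂ _<_ (y+0+0 y) (y+0+0 a) y<a) a≤y
    where
    y+0+0 : ∀ y → y + 0 + 0 ≡ y
    y+0+0 y = trans (+-identityʳ _) (+-identityʳ y)
  absurd (inj₂ (y≡a , inj₂ (_ , a<y))) = <-irrefl (+-cancelʳ-≡ 0 _ _ (+-cancelʳ-≡ 0 _ _ (sym y≡a))) a<y

z-axis-not-minimal : ∀ m → (¬ FibreMinimal (suc m) byY (0 , 0 , 2)) × (¬ FibreMinimal (suc m) byX (0 , 0 , 2))
z-axis-not-minimal m = (λ minimal → minimal (3 , 1 , 0) same-image (inj₁ (s≤s z≤n))) ,
                       (λ minimal → minimal (3 , 1 , 0) same-image (inj₁ (s≤s z≤n)))
  where
  same-image : φ (suc m) (3 , 1 , 0) ≡ φ (suc m) (0 , 0 , 2)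
  same-image = balance⇒fibre m (0 , 0 , 2) (3 , 1 , 0) refl

≰-by-excess : ∀ {a b} k → a ≡ b + suc k → a ≰ b
≰-by-excess {b = b} k refl = m+1+n≰m b

halve : ∀ b → ∃₂ λ y z → (z ≤ 1) × (2 * y + z ≡ b)
halve b = b / 2 , b % 2 , ≤-pred (m%n<n b 2) , sym (begin
  b                       ≡⟨ m≡m%n+[m/n]*n b 2 ⟩
  b % 2 + b / 2 * 2       ≡⟨ +-comm (b % 2) (b / 2 * 2) ⟩
  b / 2 * 2 + b % 2       ≡⟨ cong (_+ b % 2) (*-comm (b / 2) 2) ⟩
  2 * (b / 2) + b % 2     ∎)
  where open ≡-Reasoning

ceiling-≤ : ∀ {y z k} → z ≤ 1 → 2 * y + z ≤ 2 * k → y + z ≤ k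
ceiling-≤ {y} {k = k} z≤n le = subst (_≤ k) (sym (+-identityʳ y)) (*-cancelˡ-≤ 2 (subst (_≤ 2 * k) (+-identityʳ (2 * y)) le))
ceiling-≤ {y} {k = k} (s≤s z≤n) le = subst (_≤ k) (+-comm 1 y) (*-cancelˡ-< 2 y k (subst (_≤ 2 * k) (+-comm (2 * y) 1) le))

-- For n = 5 + 2q this is (5 + 3q) n - (3 + 2q), the Frobenius number of ⟨n, 3n - 2, 3n - 1⟩.
frobenius : ℕ → ℕ
frobenius q = 6 * q * q + 23 * q + 22

frobenius∉T : ∀ q → ¬ InT (5 + 2 * q) (frobenius q)
frobenius∉T q (v , φv≡F) = ≰-by-excess 0 (excess q)
  (deficit-bound (4 + 2 * q) v {5 + 3 * q} {1 + q} {1} (s≤s z≤n) (s≤s z≤n)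
    (subst (_< 5 + 2 * q) (sym (b≡ q)) (s≤s (s≤s (s≤s (s≤s (n≤1+n (2 * q)))))))
    (trans (cong (_+ (2 * (1 + q) + 1)) φv≡F) (F+b≡ q)))
  where
  b≡ : ∀ q → 2 * (1 + q) + 1 ≡ 3 + 2 * q
  b≡ = solve-∀
  F+b≡ : ∀ q → 6 * q * q + 23 * q + 22 + (2 * (1 + q) + 1) ≡ (5 + 3 * q) * (5 + 2 * q)
  F+b≡ = solve-∀
  excess : ∀ q → 3 * (1 + q + 1) ≡ 5 + 3 * q + 1
  excess = solve-∀

InT-+multiple : ∀ {n s} t → InT n s → InT n (s + t * n)
InT-+multiple {n} t s∈T = InT-+ s∈T ((t , 0 , 0) , trans (+-identityʳ _) (+-identityʳ (t * n)))

frobenius+1+j∈T-low : ∀ q j → j ≤ 2 + 2 * q → InT (5 + 2 * q) (frobenius q + suc j)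
frobenius+1+j∈T-low q j j≤ with m≤n⇒∃[o]m+o≡n j≤
... | b , j+b≡ with halve b
...   | y , z , z≤1 , 2y+z≡b = InT-of-deficit (4 + 2 * q) {a = 5 + 3 * q} {y} {z} bound (begin
  frobenius q + suc j + (2 * y + z)    ≡⟨ cong (frobenius q + suc j +_) 2y+z≡b ⟩
  frobenius q + suc j + b              ≡⟨ +-assoc (frobenius q) (suc j) b ⟩
  frobenius q + suc (j + b)            ≡⟨ cong (λ t → frobenius q + suc t) j+b≡ ⟩
  frobenius q + (3 + 2 * q)            ≡⟨ top q ⟩
  (5 + 3 * q) * (5 + 2 * q)            ∎)
  where
  open ≡-Reasoning
  top : ∀ q → 6 * q * q + 23 * q + 22 + (3 + 2 * q) ≡ (5 + 3 * q) * (5 + 2 * q)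
  top = solve-∀
  bound : 3 * (y + z) ≤ 5 + 3 * q
  bound = ≤-trans (*-monoʳ-≤ 3 (ceiling-≤ {y} {z} {1 + q} z≤1 b≤))
                  (m+o≡n⇒m≤n 2 (three q))
    where
    two : ∀ q → 2 + 2 * q ≡ 2 * (1 + q)
    two = solve-∀
    b≤ : 2 * y + z ≤ 2 * (1 + q)
    b≤ = subst₂ _≤_ (sym 2y+z≡b) (trans j+b≡ (two q)) (m≤n+m b j)
    three : ∀ q → 3 * (1 + q) + 2 ≡ 5 + 3 * q
    three = solve-∀

frobenius+1+j∈T-high : ∀ q j → 2 + 2 * q < j → j < 5 + 2 * q → InT (5 + 2 * q) (frobenius q + suc j)
frobenius+1+j∈T-high q j j> j<n with m≤n⇒∃[o]m+o≡n j>
... | zero , refl = InT-of-deficit (4 + 2 * q) {a = 6 + 3 * q} {2 + q} {0} (≤-reflexive (six q)) (below-next q)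
  where
  six : ∀ q → 3 * (2 + q + 0) ≡ 6 + 3 * q
  six = solve-∀
  below-next : ∀ q → 6 * q * q + 23 * q + 22 + suc (3 + 2 * q + 0) + (2 * (2 + q) + 0) ≡ (6 + 3 * q) * (5 + 2 * q)
  below-next = solve-∀
... | suc zero , refl = InT-of-deficit (4 + 2 * q) {a = 6 + 3 * q} {1 + q} {1} (≤-reflexive (six q)) (below-next q)
  where
  six : ∀ q → 3 * (1 + q + 1) ≡ 6 + 3 * q
  six = solve-∀
  below-next : ∀ q → 6 * q * q + 23 * q + 22 + suc (3 + 2 * q + 1) + (2 * (1 + q) + 1) ≡ (6 + 3 * q) * (5 + 2 * q)
  below-next = solve-∀
... | suc (suc e) , refl = contradiction j<n (<⇒≱ (s≤s (m+o≡n⇒m≤n e (beyond q e))))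
  where
  beyond : ∀ q e → 5 + 2 * q + e ≡ 3 + 2 * q + suc (suc e)
  beyond = solve-∀

frobenius+1+j∈T : ∀ q j → j < 5 + 2 * q → InT (5 + 2 * q) (frobenius q + suc j)
frobenius+1+j∈T q j j<n with j ≤? 2 + 2 * q
... | yes j≤ = frobenius+1+j∈T-low q j j≤
... | no j≰ = frobenius+1+j∈T-high q j (≰⇒> j≰) j<n

frobenius-above : ∀ q s → frobenius q < s → InT (5 + 2 * q) s
frobenius-above q s F<s with m≤n⇒∃[o]m+o≡n F<s
... | r , 1+F+r≡s = subst (InT n) s≡ (InT-+multiple (r / n) (frobenius+1+j∈T q (r % n) (m%n<n r n)))
  where
  open ≡-Reasoning
  n : ℕ
  n = 5 + 2 * q
  s≡ : frobenius q + suc (r % n) + r / n * n ≡ s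
  s≡ = begin
    frobenius q + suc (r % n) + r / n * n    ≡⟨ +-assoc (frobenius q) (suc (r % n)) (r / n * n) ⟩
    frobenius q + suc (r % n + r / n * n)    ≡⟨ cong (λ t → frobenius q + suc t) (m≡m%n+[m/n]*n r n) ⟨
    frobenius q + suc r                      ≡⟨ +-suc (frobenius q) r ⟩
    suc (frobenius q) + r                    ≡⟨ 1+F+r≡s ⟩
    s                                        ∎

frobenius-unique : ∀ q f → IsFrobeniusT (5 + 2 * q) f → f ≡ frobenius q
frobenius-unique q f (f∉T , above-f) with <-cmp f (frobenius q)
... | tri< f<F _ _ = contradiction (above-f (frobenius q) f<F) (frobenius∉T q)
... | tri≈ _ f≡F _ = f≡F
... | tri> _ _ F<f = contradiction (frobenius-above q f F<f) f∉T

z-axis-inAp : ∀ q → InAp (5 + 2 * q) (frobenius q) (φ (5 + 2 * q) (0 , 0 , 2))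
z-axis-inAp zero = inj₁ ((0 , 0 , 2) , refl) , λ _ → 6∉S
  where
  6∉S : ¬ InS 5 22 6
  6∉S (inj₁ (v , φv≡6)) = ≰-by-excess 3 refl (deficit-bound 4 v {2} {2} {0} (s≤s z≤n) z≤n ≤-refl (cong (_+ 4) φv≡6))
  6∉S (inj₂ ())
z-axis-inAp (suc p) = inj₁ ((0 , 0 , 2) , refl) , λ F≤φ _ → <⇒≱ φ<F F≤φ
  where
  φ<F : φ (5 + 2 * suc p) (0 , 0 , 2) < frobenius (suc p)
  φ<F = +-cancelʳ-< 2 _ _ (subst (_< frobenius (suc p) + 2) (sym (φ-deficit (4 + 2 * suc p) (0 , 0 , 2)))
          (m+o≡n⇒m≤n (6 * p * p + 23 * p + 10) (room p)))
    where
    room : ∀ p → suc (6 * (5 + 2 * suc p)) + (6 * p * p + 23 * p + 10) ≡ 6 * suc p * suc p + 23 * suc p + 22 + 2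
    room = solve-∀

y-range : ∀ q y → 3 + q ≤ y → y ≤ 3 + 2 * q → ∃₂ λ i r → (q ≡ i + r) × (y ≡ 3 + q + i)
y-range q y 3+q≤y y≤3+2q with m≤n⇒∃[o]m+o≡n 3+q≤y
... | i , refl with m≤n⇒∃[o]m+o≡n (+-cancelˡ-≤ (3 + q) i q (subst (3 + q + i ≤_) 3+2q≡ y≤3+2q))
  where
  3+2q≡ : 3 + 2 * q ≡ 3 + q + q
  3+2q≡ = trans (cong (λ t → 3 + (q + t)) (+-identityʳ q)) (sym (+-assoc 3 q q))
...   | r , refl = i , r , refl , refl

y-axis-inAp : ∀ q y → 3 + q ≤ y → y ≤ 3 + 2 * q → InAp (5 + 2 * q) (frobenius q) (φ (5 + 2 * q) (0 , y , 0))
y-axis-inAp q y 3+q≤y y≤3+2q with y-range q y 3+q≤y y≤3+2q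
... | i , r , refl , refl = inj₁ ((0 , y′ , 0) , refl) , shifted∉S
  where
  open ≡-Reasoning
  q′ y′ n F s D b : ℕ
  q′ = i + r
  y′ = 3 + q′ + i
  n = 5 + 2 * q′
  F = frobenius q′
  s = φ n (0 , y′ , 0)
  D = 2 * y′ + 0
  b = 2 * (1 + i) + 1
  s+D≡ : s + D ≡ (3 * y′ + 0) * n
  s+D≡ = φ-deficit (4 + 2 * q′) (0 , y′ , 0)
  shifted∉S : F ≤ s → ¬ InS n F (s ∸ F)
  shifted∉S F≤s (inj₁ (v , φv≡t)) = ≰-by-excess 1 (excess i)
    (deficit-bound (4 + 2 * q′) v {4 + 3 * i} {1 + i} {1} (s≤s z≤n) (s≤s z≤n) (m+o≡n⇒m≤n (1 + 2 * r) (b<n i r))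
      (+-cancelʳ-≡ (F + D) _ _ (begin
        φ n v + b + (F + D)               ≡⟨ cong (λ t → t + b + (F + D)) φv≡t ⟩
        s ∸ F + b + (F + D)               ≡⟨ shuffle (s ∸ F) b F D ⟩
        s ∸ F + F + D + b                 ≡⟨ cong (λ t → t + D + b) (m∸n+n≡m F≤s) ⟩
        s + D + b                         ≡⟨ cong (_+ b) s+D≡ ⟩
        (3 * y′ + 0) * n + b              ≡⟨ rebalance i r ⟩
        (4 + 3 * i) * n + (F + D)         ∎)))
    where
    excess : ∀ i → 3 * (1 + i + 1) ≡ 4 + 3 * i + suc 1
    excess = solve-∀
    b<n : ∀ i r → suc (2 * (1 + i) + 1) + (1 + 2 * r) ≡ 5 + 2 * (i + r)
    b<n = solve-∀
    shuffle : ∀ t b F D → t + b + (F + D) ≡ t + F + D + b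
    shuffle = solve-∀
    rebalance : ∀ i r → let q = i + r ; y = 3 + q + i in
                (3 * y + 0) * (5 + 2 * q) + (2 * (1 + i) + 1)
                ≡ (4 + 3 * i) * (5 + 2 * q) + (6 * q * q + 23 * q + 22 + (2 * y + 0))
    rebalance = solve-∀
  shifted∉S F≤s (inj₂ t≡F) = m≢1+m+n ((3 * y′ + 0) * n) (begin
    (3 * y′ + 0) * n                  ≡⟨ s+D≡ ⟨
    s + D                             ≡⟨ cong (_+ D) (m∸n+n≡m F≤s) ⟨
    s ∸ F + F + D                     ≡⟨ cong (λ t → t + F + D) t≡F ⟩
    F + F + D                         ≡⟨ two-frobenius i r ⟩
    suc ((3 * y′ + 0) * n + k)        ∎)
    where
    k : ℕ
    k = 6 * i * r + 6 * r * r + 2 * i + 15 * r + 4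
    two-frobenius : ∀ i r → let q = i + r ; y = 3 + q + i in
                    6 * q * q + 23 * q + 22 + (6 * q * q + 23 * q + 22) + (2 * y + 0)
                    ≡ suc ((3 * y + 0) * (5 + 2 * q) + (6 * i * r + 6 * r * r + 2 * i + 15 * r + 4))
    two-frobenius = solve-∀

-- The witness (5 + 3r , 0 , 1 + 2i) has one degree less than (0 , y , 0) and deficit smaller by n.
y-axis-not-minimal : ∀ q y → 3 + q ≤ y → y ≤ 3 + 2 * q →
  (¬ FibreMinimal (5 + 2 * q) byX (0 , y , 0))
  × (∀ T → T < y → ¬ FibreMinimal (5 + 2 * q) (weighted (5 + 2 * q) T) (0 , y , 0))
y-axis-not-minimal q y 3+q≤y y≤3+2q with y-range q y 3+q≤y y≤3+2q
... | i , r , refl , refl =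
  (λ minimal → minimal v same-image (inj₁ (s≤s z≤n))) ,
  (λ T T<y minimal → minimal v same-image
     (weighted-≺-intro (4 + 2 * q′) T 1 (deficit-step i r) (subst (_< y′) (sym (*-identityʳ T)) T<y)))
  where
  q′ y′ : ℕ
  q′ = i + r
  y′ = 3 + q′ + i
  v : ℕ³
  v = (5 + 3 * r , 0 , 1 + 2 * i)
  balance : ∀ i r → let q = i + r ; y = 3 + q + i in
            (5 + 3 * r + 3 * 0 + 3 * (1 + 2 * i)) * (5 + 2 * q) + (2 * y + 0)
            ≡ (0 + 3 * y + 3 * 0) * (5 + 2 * q) + (2 * 0 + (1 + 2 * i))
  balance = solve-∀
  same-image : φ (5 + 2 * q′) v ≡ φ (5 + 2 * q′) (0 , y′ , 0)
  same-image = balance⇒fibre (4 + 2 * q′) (0 , y′ , 0) v (balance i r)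
  deficit-step : ∀ i r → 2 * 0 + (1 + 2 * i) + 1 * (5 + 2 * (i + r)) ≡ 2 * (3 + (i + r) + i) + 0
  deficit-step = solve-∀

order : ℕ → ℕ → WeightOrder
order q zero = byY
order q (suc zero) = byX
order q (suc (suc j)) = weighted (5 + 2 * q) (2 + q + j)

module Shape (q k : ℕ) = OrderLShape (4 + 2 * q) (frobenius q) (frobenius-above q) (order q k)

∉-Shape : ∀ q k v → ¬ FibreMinimal (5 + 2 * q) (order q k) v → Shape.L q k v ≢ true
∉-Shape q k v ¬minimal Lv = ¬minimal (proj₂ (Shape.L-elim q k v Lv))

separates : ∀ {a b : Bool} → a ≡ true → b ≢ true → a ≢ b
separates a≡true b≢true a≡b = b≢true (trans (sym a≡b) a≡true)

distinct-shapes : ∀ q {k k′} → k < k′ → k′ < 4 + q → ∃ λ v → Shape.L q k v ≢ Shape.L q k′ v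
distinct-shapes q {zero} {suc zero} _ _ = (0 , 3 + 2 * q , 0) ,
  separates (Shape.L-intro q 0 _ (y-axis-inAp q (3 + 2 * q) 3+q≤3+2q ≤-refl) (y-axis-minimal-byY (4 + 2 * q) _))
            (∉-Shape q 1 _ (proj₁ (y-axis-not-minimal q (3 + 2 * q) 3+q≤3+2q ≤-refl)))
  where
  3+q≤3+2q : 3 + q ≤ 3 + 2 * q
  3+q≤3+2q = +-monoʳ-≤ 3 (m≤m+n q (q + 0))
distinct-shapes q {zero} {suc (suc j)} _ _ = (0 , 0 , 2) ,
  λ e → separates (Shape.L-intro q (2 + j) _ (z-axis-inAp q) (z-axis-minimal-weighted (4 + 2 * q) (2 + q + j) (s≤s (s≤s z≤n))))
                  (∉-Shape q 0 _ (proj₁ (z-axis-not-minimal (4 + 2 * q)))) (sym e)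
distinct-shapes q {suc zero} {suc (suc j)} _ _ = (0 , 0 , 2) ,
  λ e → separates (Shape.L-intro q (2 + j) _ (z-axis-inAp q) (z-axis-minimal-weighted (4 + 2 * q) (2 + q + j) (s≤s (s≤s z≤n))))
                  (∉-Shape q 1 _ (proj₂ (z-axis-not-minimal (4 + 2 * q)))) (sym e)
distinct-shapes q {suc (suc j)} {suc (suc j′)} j<j′ j′<top = (0 , y , 0) ,
  λ e → separates (Shape.L-intro q (2 + j′) _ (y-axis-inAp q y 3+q≤y y≤3+2q)
                     (y-axis-minimal-weighted (4 + 2 * q) y y 1≤y ≤-refl))
                  (∉-Shape q (2 + j) _ (proj₂ (y-axis-not-minimal q y 3+q≤y y≤3+2q) (2 + q + j)
                     (+-monoʳ-< (2 + q) (s<s⁻¹ (s<s⁻¹ j<j′)))))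
                  (sym e)
  where
  y : ℕ
  y = 2 + q + j′
  1≤j′ : 1 ≤ j′
  1≤j′ = ≤-trans (s≤s z≤n) (s<s⁻¹ (s<s⁻¹ j<j′))
  3+q≤y : 3 + q ≤ y
  3+q≤y = subst (_≤ y) (+-comm (2 + q) 1) (+-monoʳ-≤ (2 + q) 1≤j′)
  y≤3+2q : y ≤ 3 + 2 * q
  y≤3+2q = subst (y ≤_) (top q) (+-monoʳ-≤ (2 + q) (≤-pred (s<s⁻¹ (s<s⁻¹ j′<top))))
    where
    top : ∀ q → 2 + q + (1 + q) ≡ 3 + 2 * q
    top = solve-∀
  1≤y : 1 ≤ y
  1≤y = s≤s z≤n
distinct-shapes q {suc zero} {suc zero} (s≤s ()) _
distinct-shapes q {suc (suc _)} {suc zero} (s≤s ()) _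

odd-form : ∀ {n} h → 5 ≤ n → n ≡ 1 + h * 2 → ∃ λ q → n ≡ 5 + 2 * q
odd-form zero (s≤s ()) refl
odd-form (suc zero) (s≤s (s≤s (s≤s ()))) refl
odd-form (suc (suc q)) _ refl = q , regroup q
  where
  regroup : ∀ q → 1 + (2 + q) * 2 ≡ 5 + 2 * q
  regroup = solve-∀

mainTheorem2 : (n : ℕ) → 5 ≤ n → n % 2 ≡ 1 → (f : ℕ) → IsFrobeniusT n f →
    Σ ℕ λ k → ((n + 3) / 2 ≤ k) × Σ (Fin k → ℕ³ → Bool) λ Ls →
      (∀ i → IsLShape n f (Ls i))
      × (∀ i j → ¬ i ≡ j → ∃ λ v → ¬ Ls i v ≡ Ls j v)
mainTheorem2 n 5≤n odd f isFrobenius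
  with odd-form (n / 2) 5≤n (trans (m≡m%n+[m/n]*n n 2) (cong (_+ n / 2 * 2) odd))
... | q , refl with frobenius-unique q f isFrobenius
...   | refl = 4 + q , ≤-reflexive count , (λ i → Shape.L q (toℕ i)) , (λ i → Shape.L-isLShape q (toℕ i)) , distinct
  where
  count : (5 + 2 * q + 3) / 2 ≡ 4 + q
  count = trans (cong (_/ 2) (double q)) (m*n/n≡m (4 + q) 2)
    where
    double : ∀ q → 5 + 2 * q + 3 ≡ (4 + q) * 2
    double = solve-∀
  distinct : ∀ i j → i ≢ j → ∃ λ v → Shape.L q (toℕ i) v ≢ Shape.L q (toℕ j) v
  distinct i j i≢j with <-cmp (toℕ i) (toℕ j)
  ... | tri< i<j _ _ = distinct-shapes q i<j (toℕ<n j)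
  ... | tri≈ _ i≡j _ = contradiction (toℕ-injective i≡j) i≢j
  ... | tri> _ _ j<i = map₂ (λ ne → ne ∘ sym) (distinct-shapes q j<i (toℕ<n i))
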